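{- For any precedence $>$, the relation $>_{\mathrm{acmpo}}$ is AC-compatible: if $s=_{\mathrm{AC}}s'$, $s'>_{\mathrm{acmpo}}t'$ and $t'=_{\mathrm{AC}}t$, then $s>_{\mathrm{acmpo}}t$.
   Context: $\mathcal{F}$ is a signature of function symbols with arities, $\mathcal{V}$ a set of variables, $\mathcal{F}_{\mathrm{AC}}\subseteq\mathcal{F}$ a set of binary symbols; $=_{\mathrm{AC}}$ is the congruence generated by $f(f(x,y),z)\approx f(x,f(y,z))$ and $f(x,y)\approx f(y,x)$ for $f\in\mathcal{F}_{\mathrm{AC}}$. $\mathrm{root}(t)$ is $t$ for a variable and $f$ for $t=f(t_1,\dots,t_n)$. For non-variable $t=f(t_1,\dots,t_n)$, $\mathrm{TF}(t)=\mathrm{TF}_f(t_1)\uplus\cdots\uplus\mathrm{TF}_f(t_n)$, where $\mathrm{TF}_f(u)=\mathrm{TF}_f(u_1)\uplus\mathrm{TF}_f(u_2)$ if $u=f(u_1,u_2)$ and $f\in\mathcal{F}_{\mathrm{AC}}$, and $\mathrm{TF}_f(u)=\{u\}$ otherwise. $=_{\mathrm{AC}}^{\mathrm{mul}}$: $\varnothing=_{\mathrm{AC}}^{\mathrm{mul}}\varnothing$, and $\{s\}\uplus M=_{\mathrm{AC}}^{\mathrm{mul}}\{t\}\uplus N$ if $s=_{\mathrm{AC}}t$ and $M=_{\mathrm{AC}}^{\mathrm{mul}}N$. A precedence is a strict order $>$ on $\mathcal{F}$. $s>_{\mathrm{acmpo}}t$ iff $s\notin\mathcal{V}$ and one of: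 (1) some $s'\in\mathrm{TF}(s)$ has $s'>_{\mathrm{acmpo}}t$ or $s'=_{\mathrm{AC}}t$; (2) $\mathrm{root}(s)>\mathrm{root}(t)$ and $s>_{\mathrm{acmpo}}t'$ for all $t'\in\mathrm{TF}(t)$; (3) $\mathrm{root}(s)=\mathrm{root}(t)$ and there are multisets with $\mathrm{TF}(s)=S_1\uplus S_2$, $\mathrm{TF}(t)=T_1\uplus T_2$, $S_1=_{\mathrm{AC}}^{\mathrm{mul}}T_1$, $S_2\ne\varnothing$, and each $t'\in T_2$ has some $s'\in S_2$ with $s'>_{\mathrm{acmpo}}t'$. -}

module Defs where

open import Data.Nat using (ℕ)
open import Data.Vec using (Vec; []; _∷_)
open import Data.Vec.Relation.Binary.Pointwise.Inductive using (Pointwise)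
open import Data.List using (List; []; _∷_; _++_)
open import Data.List.Membership.Propositional using (_∈_)
open import Data.List.Relation.Binary.Permutation.Propositional using (_↭_)
open import Data.Product using (Σ; ∃; _×_; _,_)
open import Data.Sum using (_⊎_)
open import Relation.Nullary using (¬_)
open import Relation.Binary.PropositionalEquality using (_≡_; subst; sym)

module Terms (Sym : Set) (arity : Sym → ℕ) (AC : Sym → Set)
             (AC-binary : ∀ {f} → AC f → arity f ≡ 2) (V : Set) where

  data Term : Set where
    var : V → Term
    fun : (f : Sym) → Vec Term (arity f) → Term

  bin : (f : Sym) → arity f ≡ 2 → Term → Term → Term
  bin f eq u₁ u₂ = fun f (subst (Vec Term) (sym eq) (u₁ ∷ u₂ ∷ []))

  infix 4 _=AC_
  data _=AC_ : Term → Term → Set where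
    ac-refl  : ∀ {s} → s =AC s
    ac-sym   : ∀ {s t} → s =AC t → t =AC s
    ac-trans : ∀ {s t u} → s =AC t → t =AC u → s =AC u
    ac-cong  : ∀ f {ss ts : Vec Term (arity f)} →
               Pointwise _=AC_ ss ts → fun f ss =AC fun f ts
    ac-assoc : ∀ f (acf : AC f) x y z →
               bin f (AC-binary acf) (bin f (AC-binary acf) x y) z
                 =AC bin f (AC-binary acf) x (bin f (AC-binary acf) y z)
    ac-comm  : ∀ f (acf : AC f) x y →
               bin f (AC-binary acf) x y =AC bin f (AC-binary acf) y x

  IsACApp : Sym → Term → Set
  IsACApp f u = AC f × Σ (arity f ≡ 2) λ eq → ∃ λ u₁ → ∃ λ u₂ → u ≡ bin f eq u₁ u₂

  -- TF_f(u) ≡ L  (multisets represented as lists, read up to permutation)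
  data TFf (f : Sym) : Term → List Term → Set where
    tf-split : ∀ (acf : AC f) {u₁ u₂ L₁ L₂} →
               TFf f u₁ L₁ → TFf f u₂ L₂ →
               TFf f (bin f (AC-binary acf) u₁ u₂) (L₁ ++ L₂)
    tf-leaf  : ∀ {u} → ¬ IsACApp f u → TFf f u (u ∷ [])

  data TFfs (f : Sym) : ∀ {n} → Vec Term n → List Term → Set where
    []  : TFfs f [] []
    _∷_ : ∀ {n u L M} {us : Vec Term n} → TFf f u L → TFfs f us M → TFfs f (u ∷ us) (L ++ M)

  data TF : Term → List Term → Set where
    tf : ∀ f {ts L} → TFfs f ts L → TF (fun f ts) L

  data RootIs : Term → Sym → Set where
    root : ∀ f {ts} → RootIs (fun f ts) f

  data _=mul_ : List Term → List Term → Set where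
    mul-[] : [] =mul []
    mul-∷  : ∀ {A B s t M N} → A ↭ s ∷ M → B ↭ t ∷ N →
             s =AC t → M =mul N → A =mul B

  module ACMPO (_>_ : Sym → Sym → Set) where

    infix 4 _>acmpo_
    data _>acmpo_ : Term → Term → Set where
      acmpo1 : ∀ {s t L} → TF s L →
               (∃ λ s′ → s′ ∈ L × (s′ >acmpo t ⊎ s′ =AC t)) →
               s >acmpo t
      acmpo2 : ∀ {s t f g L} → RootIs s f → RootIs t g → f > g → TF t L →
               (∀ {t′} → t′ ∈ L → s >acmpo t′) →
               s >acmpo t
      acmpo3 : ∀ {s t f Ls Lt S₁ S₂ T₁ T₂} → RootIs s f → RootIs t f →
               TF s Ls → TF t Lt →
               Ls ↭ S₁ ++ S₂ → Lt ↭ T₁ ++ T₂ →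
               S₁ =mul T₁ → ¬ S₂ ≡ [] →
               (∀ {t′} → t′ ∈ T₂ → ∃ λ s′ → s′ ∈ S₂ × s′ >acmpo t′) →
               s >acmpo t

-- An AC-step only regroups or reorders the arguments of an AC symbol, and a
-- congruence step acts argument-wise; hence AC-equal terms have the same root
-- and, for every f, AC-equal flattenings TF_f, so also AC-equal multisets TF.
-- Each clause of >acmpo only inspects these multisets up to =AC^mul, so it
-- transfers along =AC, by induction on the derivation of s′ >acmpo t′.
module Submission where

open import Defs
open import Data.Nat using (ℕ)
open import Relation.Binary.PropositionalEquality using (_≡_)
open import Relation.Binary.Structures using (IsStrictPartialOrder)

open import Data.Empty using (⊥-elim)
open import Data.List using (List; []; _∷_; _++_)
open import Data.List.Properties using (++-assoc; ++-identityʳ)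
open import Data.List.Membership.Propositional using (_∈_; find)
open import Data.List.Relation.Binary.Permutation.Propositional
  using (_↭_; ↭-refl; ↭-reflexive; ↭-sym; ↭-trans)
open import Data.List.Relation.Binary.Permutation.Propositional.Properties
  using (↭-empty-inv; ∈-resp-↭) renaming (++⁺ to ↭-++⁺; ++-comm to ↭-++-comm)
import Data.List.Relation.Unary.Any as Any
open import Data.Maybe using (Maybe; just; nothing)
open import Data.Product using (∃; ∃₂; _×_; _,_; proj₁; proj₂; swap)
open import Data.Sum using (inj₁; inj₂)
open import Data.Vec using (Vec; []; _∷_; toList)
open import Function using (_∘_)
open import Relation.Binary.PropositionalEquality using (refl; cong; subst; sym; trans)

import Data.List.Relation.Binary.Permutation.Propositional as ↭
open import Data.List.Relation.Binary.Pointwise as ListPw using ([]; _∷_)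
open import Data.Vec.Relation.Binary.Pointwise.Inductive as VecPw using ([]; _∷_)

module AC-Compatibility (Sym : Set) (arity : Sym → ℕ) (AC : Sym → Set)
                        (AC-binary : ∀ {f} → AC f → arity f ≡ 2) (V : Set) where
  open Terms Sym arity AC AC-binary V

  infix 4 _≋_
  _≋_ : List Term → List Term → Set
  _≋_ = ListPw.Pointwise _=AC_

  ≋-refl : ∀ {A} → A ≋ A
  ≋-refl = ListPw.refl ac-refl

  ≋-trans : ∀ {A B C} → A ≋ B → B ≋ C → A ≋ C
  ≋-trans = ListPw.transitive ac-trans

  ≋-++⁻ : ∀ {C} Y {Z} → C ≋ Y ++ Z → ∃₂ λ C₁ C₂ → C ≡ C₁ ++ C₂ × C₁ ≋ Y × C₂ ≋ Z
  ≋-++⁻ []      c≋z      = [] , _ , refl , [] , c≋z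
  ≋-++⁻ (_ ∷ Y) (r ∷ rs) with C₁ , C₂ , refl , c₁≋y , c₂≋z ← ≋-++⁻ Y rs =
    _ ∷ C₁ , C₂ , refl , r ∷ c₁≋y , c₂≋z

  ≋-↭-commute : ∀ {A B C} → A ≋ B → B ↭ C → ∃ λ A′ → A ↭ A′ × A′ ≋ C
  ≋-↭-commute a≋b ↭.refl = _ , ↭-refl , a≋b
  ≋-↭-commute (r ∷ rs) (↭.prep _ π) with A′ , σ , a′≋c ← ≋-↭-commute rs π =
    _ , ↭.prep _ σ , r ∷ a′≋c
  ≋-↭-commute (r₁ ∷ r₂ ∷ rs) (↭.swap _ _ π) with A′ , σ , a′≋c ← ≋-↭-commute rs π =
    _ , ↭.swap _ _ σ , r₂ ∷ r₁ ∷ a′≋c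
  ≋-↭-commute a≋b (↭.trans π₁ π₂)
    with A₁ , σ₁ , a₁≋ ← ≋-↭-commute a≋b π₁
    with A₂ , σ₂ , a₂≋ ← ≋-↭-commute a₁≋ π₂ = A₂ , ↭-trans σ₁ σ₂ , a₂≋

  -- Every proof of A =mul B factors as a permutation followed by pointwise =AC;
  -- the remaining multiset laws are read off this normal form.
  =mul⇒↭≋ : ∀ {A B} → A =mul B → ∃ λ C → A ↭ C × C ≋ B
  =mul⇒↭≋ mul-[] = [] , ↭-refl , []
  =mul⇒↭≋ (mul-∷ p q r m)
    with C , π , c≋n ← =mul⇒↭≋ m
    with C′ , σ , c′≋b ← ≋-↭-commute (r ∷ c≋n) (↭-sym q) =
    C′ , ↭-trans p (↭-trans (↭.prep _ π) σ) , c′≋b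

  ↭≋⇒=mul : ∀ {A B C} → A ↭ C → C ≋ B → A =mul B
  ↭≋⇒=mul π [] with refl ← ↭-empty-inv π = mul-[]
  ↭≋⇒=mul π (r ∷ rs) = mul-∷ π ↭-refl r (↭≋⇒=mul ↭-refl rs)

  ↭⇒=mul : ∀ {A B} → A ↭ B → A =mul B
  ↭⇒=mul π = ↭≋⇒=mul π ≋-refl

  =mul-refl : ∀ {A} → A =mul A
  =mul-refl = ↭⇒=mul ↭-refl

  =mul-sym : ∀ {A B} → A =mul B → B =mul A
  =mul-sym mul-[]          = mul-[]
  =mul-sym (mul-∷ p q r m) = mul-∷ q p (ac-sym r) (=mul-sym m)

  =mul-trans : ∀ {A B C} → A =mul B → B =mul C → A =mul C
  =mul-trans m n
    with C₁ , π₁ , c₁≋b ← =mul⇒↭≋ m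
    with C₂ , π₂ , c₂≋c ← =mul⇒↭≋ n
    with D , σ , d≋c₂ ← ≋-↭-commute c₁≋b π₂ = ↭≋⇒=mul (↭-trans π₁ σ) (≋-trans d≋c₂ c₂≋c)

  =mul-++⁺ : ∀ {A B C D} → A =mul B → C =mul D → (A ++ C) =mul (B ++ D)
  =mul-++⁺ m n
    with _ , π₁ , r₁ ← =mul⇒↭≋ m
    with _ , π₂ , r₂ ← =mul⇒↭≋ n = ↭≋⇒=mul (↭-++⁺ π₁ π₂) (ListPw.++⁺ r₁ r₂)

  =mul-∈ : ∀ {A B x} → A =mul B → x ∈ A → ∃ λ y → y ∈ B × x =AC y
  =mul-∈ m x∈A with _ , π , c≋b ← =mul⇒↭≋ m =
    find (ListPw.Any-resp-Pointwise (λ r q → ac-trans q r) c≋b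
           (Any.map (λ { refl → ac-refl }) (∈-resp-↭ π x∈A)))

  =mul-++⁻ : ∀ {X} Y {Z} → X =mul (Y ++ Z) →
             ∃₂ λ Y′ Z′ → X ↭ Y′ ++ Z′ × Y′ =mul Y × Z′ =mul Z
  =mul-++⁻ Y m
    with _ , π , c≋yz ← =mul⇒↭≋ m
    with C₁ , C₂ , refl , c₁≋y , c₂≋z ← ≋-++⁻ Y c≋yz =
    C₁ , C₂ , π , ↭≋⇒=mul ↭-refl c₁≋y , ↭≋⇒=mul ↭-refl c₂≋z

  =mul-empty-inv : ∀ {Z} → [] =mul Z → Z ≡ []
  =mul-empty-inv mul-[] = refl
  =mul-empty-inv (mul-∷ p _ _ _) with () ← ↭-empty-inv (↭-sym p)

  rootSym : Term → Maybe Sym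
  rootSym (var _)   = nothing
  rootSym (fun f _) = just f

  rootSym-=AC : ∀ {s t} → s =AC t → rootSym s ≡ rootSym t
  rootSym-=AC ac-refl                = refl
  rootSym-=AC (ac-sym p)             = sym (rootSym-=AC p)
  rootSym-=AC (ac-trans p q)         = trans (rootSym-=AC p) (rootSym-=AC q)
  rootSym-=AC (ac-cong _ _)          = refl
  rootSym-=AC (ac-assoc _ _ _ _ _)   = refl
  rootSym-=AC (ac-comm _ _ _ _)      = refl

  RootIs-resp-=AC : ∀ {s t f} → s =AC t → RootIs s f → RootIs t f
  RootIs-resp-=AC {t = var _}   p (root _) with () ← rootSym-=AC p
  RootIs-resp-=AC {t = fun g _} p (root _) with refl ← rootSym-=AC p = root g

  args : Term → List Term
  args (var _)    = []
  args (fun _ ts) = toList ts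

  toList-pair : ∀ {n} (e : n ≡ 2) (a b : Term) →
                toList (subst (Vec Term) (sym e) (a ∷ b ∷ [])) ≡ a ∷ b ∷ []
  toList-pair refl a b = refl

  bin-injective : ∀ {f g e e′ a b c d} → bin f e a b ≡ bin g e′ c d → f ≡ g × a ≡ c × b ≡ d
  bin-injective {e = e} {e′} {a} {b} {c} {d} eq
    with refl ← cong rootSym eq
    with refl ← trans (sym (toList-pair e a b)) (trans (cong args eq) (toList-pair e′ c d)) =
    refl , refl , refl

  vec-pair : ∀ {n} (e : n ≡ 2) (ts : Vec Term n) →
             ∃₂ λ a b → ts ≡ subst (Vec Term) (sym e) (a ∷ b ∷ [])
  vec-pair refl (a ∷ b ∷ []) = a , b , refl

  IsACApp-resp-rootSym : ∀ {f s t} → rootSym s ≡ rootSym t → IsACApp f s → IsACApp f t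
  IsACApp-resp-rootSym {t = var _} () (_ , _ , _ , _ , refl)
  IsACApp-resp-rootSym {t = fun _ ts} refl (acf , e , _ , _ , refl)
    with a , b , refl ← vec-pair e ts = acf , e , a , b , refl

  Pointwise-pairˡ : ∀ {R : Term → Term → Set} {n} (e : n ≡ 2) {a₁ a₂} {ts : Vec Term n} →
                    VecPw.Pointwise R (subst (Vec Term) (sym e) (a₁ ∷ a₂ ∷ [])) ts →
                    ∃₂ λ b₁ b₂ → ts ≡ subst (Vec Term) (sym e) (b₁ ∷ b₂ ∷ []) × R a₁ b₁ × R a₂ b₂
  Pointwise-pairˡ refl (r₁ ∷ r₂ ∷ []) = _ , _ , refl , r₁ , r₂

  TFf-bin⁻ : ∀ {f e a b L} → AC f → TFf f (bin f e a b) L →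
             ∃₂ λ La Lb → TFf f a La × TFf f b Lb × L ≡ La ++ Lb
  TFf-bin⁻ {f} {e} {a} {b} acf d = go d refl
    where
    go : ∀ {u L} → TFf f u L → u ≡ bin f e a b → ∃₂ λ La Lb → TFf f a La × TFf f b Lb × L ≡ La ++ Lb
    go (tf-leaf ¬ac) eq = ⊥-elim (¬ac (acf , e , a , b , eq))
    go (tf-split _ d₁ d₂) eq with refl , refl , refl ← bin-injective eq = _ , _ , d₁ , d₂ , refl

  record Transfer {I : Set} (D : I → List Term → Set) (x y : I) : Set where
    constructor mk-transfer
    field transfer : ∀ {L} → D x L → ∃ λ M → D y M × L =mul M
  open Transfer

  Transfer↔ : {I : Set} → (I → List Term → Set) → I → I → Set
  Transfer↔ D x y = Transfer D x y × Transfer D y x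

  transfer-refl : ∀ {I} {D : I → List Term → Set} {x} → Transfer D x x
  transfer-refl = mk-transfer λ d → _ , d , =mul-refl

  transfer-trans : ∀ {I} {D : I → List Term → Set} {x y z} →
                   Transfer D x y → Transfer D y z → Transfer D x z
  transfer-trans T U .transfer d
    with _ , d′ , m ← transfer T d
    with _ , d″ , m′ ← transfer U d′ = _ , d″ , =mul-trans m m′

  transfer-++ : ∀ {I} {D : I → List Term → Set} {x y L S₁ S₂} →
                Transfer D x y → D x L → L ↭ S₁ ++ S₂ →
                ∃ λ M → D y M × ∃₂ λ S₁′ S₂′ → M ↭ S₁′ ++ S₂′ × S₁′ =mul S₁ × S₂′ =mul S₂
  transfer-++ {S₁ = S₁} T d π with M , d′ , m ← transfer T d =
    M , d′ , =mul-++⁻ S₁ (=mul-trans (=mul-sym m) (↭⇒=mul π))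

  transfer↔-trans : ∀ {I} {D : I → List Term → Set} {x y z} →
                    Transfer↔ D x y → Transfer↔ D y z → Transfer↔ D x z
  transfer↔-trans (T , T⁻) (U , U⁻) = transfer-trans T U , transfer-trans U⁻ T⁻

  SplitTransfer : Sym → Term → Term → Set
  SplitTransfer f s t = ∀ {acf u₁ u₂ L₁ L₂} → s ≡ bin f (AC-binary acf) u₁ u₂ →
                        TFf f u₁ L₁ → TFf f u₂ L₂ → ∃ λ M → TFf f t M × (L₁ ++ L₂) =mul M

  -- Only the split case needs work: a leaf of TF_f stays a leaf along =AC,
  -- because IsACApp f depends only on the root.
  TFf-transfer-by-splits : ∀ {f s t} → s =AC t → SplitTransfer f s t → Transfer (TFf f) s t
  TFf-transfer-by-splits p split .transfer (tf-leaf ¬ac) =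
    _ , tf-leaf (¬ac ∘ IsACApp-resp-rootSym (sym (rootSym-=AC p))) , ↭≋⇒=mul ↭-refl (p ∷ [])
  TFf-transfer-by-splits p split .transfer (tf-split _ d₁ d₂) = split refl d₁ d₂

  TFf-transfer-cong : ∀ {f g ss ts} → VecPw.Pointwise _=AC_ ss ts →
                      VecPw.Pointwise (Transfer↔ (TFf f)) ss ts →
                      Transfer (TFf f) (fun g ss) (fun g ts)
  TFf-transfer-cong {f} {g} {ss} {ts} pw T = TFf-transfer-by-splits (ac-cong g pw) split
    where
    split : SplitTransfer f (fun g ss) (fun g ts)
    split {acf} refl d₁ d₂
      with _ , _ , refl , (T₁ , _) , (T₂ , _) ← Pointwise-pairˡ (AC-binary acf) T
      with _ , d₁′ , m₁ ← transfer T₁ d₁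
      with _ , d₂′ , m₂ ← transfer T₂ d₂ = _ , tf-split acf d₁′ d₂′ , =mul-++⁺ m₁ m₂

  module _ {g} (acg : AC g) where
    private
      _∙_ : Term → Term → Term
      x ∙ y = bin g (AC-binary acg) x y

    TFf-transfer-assoc : ∀ {f} x y z → Transfer (TFf f) ((x ∙ y) ∙ z) (x ∙ (y ∙ z))
    TFf-transfer-assoc {f} x y z = TFf-transfer-by-splits (ac-assoc g acg x y z) split
      where
      split : SplitTransfer f ((x ∙ y) ∙ z) (x ∙ (y ∙ z))
      split eq dxy dz
        with refl , refl , refl ← bin-injective eq
        with Lx , Ly , dx , dy , refl ← TFf-bin⁻ acg dxy =
        _ , tf-split acg dx (tf-split acg dy dz) , ↭⇒=mul (↭-reflexive (++-assoc Lx Ly _))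

    TFf-transfer-unassoc : ∀ {f} x y z → Transfer (TFf f) (x ∙ (y ∙ z)) ((x ∙ y) ∙ z)
    TFf-transfer-unassoc {f} x y z = TFf-transfer-by-splits (ac-sym (ac-assoc g acg x y z)) split
      where
      split : SplitTransfer f (x ∙ (y ∙ z)) ((x ∙ y) ∙ z)
      split eq dx dyz
        with refl , refl , refl ← bin-injective eq
        with Ly , Lz , dy , dz , refl ← TFf-bin⁻ acg dyz =
        _ , tf-split acg (tf-split acg dx dy) dz , ↭⇒=mul (↭-reflexive (sym (++-assoc _ Ly Lz)))

    TFf-transfer-comm : ∀ {f} x y → Transfer (TFf f) (x ∙ y) (y ∙ x)
    TFf-transfer-comm {f} x y = TFf-transfer-by-splits (ac-comm g acg x y) split
      where
      split : SplitTransfer f (x ∙ y) (y ∙ x)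
      split {L₁ = L₁} {L₂} eq dx dy with refl , refl , refl ← bin-injective eq =
        _ , tf-split acg dy dx , ↭⇒=mul (↭-++-comm L₁ L₂)

  TFf-transfer : ∀ {f s t} → s =AC t → Transfer↔ (TFf f) s t
  TFf-transfer-pointwise : ∀ {f n} {ss ts : Vec Term n} → VecPw.Pointwise _=AC_ ss ts →
                           VecPw.Pointwise (Transfer↔ (TFf f)) ss ts

  TFf-transfer ac-refl                  = transfer-refl , transfer-refl
  TFf-transfer (ac-sym p)               = swap (TFf-transfer p)
  TFf-transfer (ac-trans p q)           = transfer↔-trans (TFf-transfer p) (TFf-transfer q)
  TFf-transfer (ac-cong g pw)           =
    TFf-transfer-cong pw T , TFf-transfer-cong (VecPw.sym ac-sym pw) (VecPw.sym swap T)
    where T = TFf-transfer-pointwise pw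
  TFf-transfer (ac-assoc g acg x y z)   =
    TFf-transfer-assoc acg x y z , TFf-transfer-unassoc acg x y z
  TFf-transfer (ac-comm g acg x y)      = TFf-transfer-comm acg x y , TFf-transfer-comm acg y x

  TFf-transfer-pointwise []       = []
  TFf-transfer-pointwise (r ∷ rs) = TFf-transfer r ∷ TFf-transfer-pointwise rs

  TFfs-pair⁻ : ∀ {f n} (e : n ≡ 2) {a b L} → TFfs f (subst (Vec Term) (sym e) (a ∷ b ∷ [])) L →
               ∃₂ λ La Lb → TFf f a La × TFf f b Lb × L ≡ La ++ Lb ++ []
  TFfs-pair⁻ refl (da ∷ db ∷ []) = _ , _ , da , db , refl

  TFfs-pair⁺ : ∀ {f n} (e : n ≡ 2) {a b La Lb} → TFf f a La → TFf f b Lb →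
               TFfs f (subst (Vec Term) (sym e) (a ∷ b ∷ [])) (La ++ Lb ++ [])
  TFfs-pair⁺ refl da db = da ∷ db ∷ []

  module _ {f} (acf : AC f) where
    private
      _∙_ : Term → Term → Term
      x ∙ y = bin f (AC-binary acf) x y

    TF-bin⇒TFf : ∀ {a b L} → TF (a ∙ b) L → ∃ λ M → TFf f (a ∙ b) M × L =mul M
    TF-bin⇒TFf (tf _ ds) with La , Lb , da , db , refl ← TFfs-pair⁻ (AC-binary acf) ds =
      _ , tf-split acf da db , ↭⇒=mul (↭-reflexive (cong (La ++_) (++-identityʳ Lb)))

    TFf⇒TF-bin : ∀ {a b L} → TFf f (a ∙ b) L → ∃ λ M → TF (a ∙ b) M × L =mul M
    TFf⇒TF-bin d with La , Lb , da , db , refl ← TFf-bin⁻ acf d =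
      _ , tf f (TFfs-pair⁺ (AC-binary acf) da db) ,
      ↭⇒=mul (↭-reflexive (sym (cong (La ++_) (++-identityʳ Lb))))

    TF-transfer-bin : ∀ {a b c d} → Transfer (TFf f) (a ∙ b) (c ∙ d) → Transfer TF (a ∙ b) (c ∙ d)
    TF-transfer-bin T .transfer d
      with _ , d₁ , m₁ ← TF-bin⇒TFf d
      with _ , d₂ , m₂ ← transfer T d₁
      with _ , d₃ , m₃ ← TFf⇒TF-bin d₂ = _ , d₃ , =mul-trans m₁ (=mul-trans m₂ m₃)

  TFfs-transfer : ∀ {f n} {ss ts : Vec Term n} →
                  VecPw.Pointwise (Transfer↔ (TFf f)) ss ts → Transfer (TFfs f) ss ts
  TFfs-transfer []       .transfer []       = _ , [] , mul-[]
  TFfs-transfer (T ∷ Ts) .transfer (d ∷ ds)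
    with _ , d′ , m ← transfer (proj₁ T) d
    with _ , ds′ , ms ← transfer (TFfs-transfer Ts) ds = _ , d′ ∷ ds′ , =mul-++⁺ m ms

  TF-transfer-cong : ∀ {g ss ts} → VecPw.Pointwise _=AC_ ss ts → Transfer TF (fun g ss) (fun g ts)
  TF-transfer-cong pw .transfer (tf g ds)
    with _ , ds′ , m ← transfer (TFfs-transfer (TFf-transfer-pointwise pw)) ds = _ , tf g ds′ , m

  TF-transfer : ∀ {s t} → s =AC t → Transfer↔ TF s t
  TF-transfer ac-refl                    = transfer-refl , transfer-refl
  TF-transfer (ac-sym p)                 = swap (TF-transfer p)
  TF-transfer (ac-trans p q)             = transfer↔-trans (TF-transfer p) (TF-transfer q)
  TF-transfer (ac-cong _ pw)             = TF-transfer-cong pw , TF-transfer-cong (VecPw.sym ac-sym pw)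
  TF-transfer p@(ac-assoc _ acg _ _ _)   =
    TF-transfer-bin acg (proj₁ (TFf-transfer p)) , TF-transfer-bin acg (proj₂ (TFf-transfer p))
  TF-transfer p@(ac-comm _ acg _ _)      =
    TF-transfer-bin acg (proj₁ (TFf-transfer p)) , TF-transfer-bin acg (proj₂ (TFf-transfer p))

  module _ (_>_ : Sym → Sym → Set) where
    open ACMPO _>_

    >acmpo-resp-=AC : ∀ {s s′ t′ t} → s =AC s′ → s′ >acmpo t′ → t′ =AC t → s >acmpo t
    >acmpo-resp-=AC s≈s′ (acmpo1 tf-s′ (u′ , u′∈ , u′≥t′)) t′≈t
      with _ , tf-s , m ← transfer (proj₂ (TF-transfer s≈s′)) tf-s′
      with u , u∈ , u′≈u ← =mul-∈ m u′∈
      with u′≥t′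
    ... | inj₁ u′>t′ = acmpo1 tf-s (u , u∈ , inj₁ (>acmpo-resp-=AC (ac-sym u′≈u) u′>t′ t′≈t))
    ... | inj₂ u′≈t′ = acmpo1 tf-s (u , u∈ , inj₂ (ac-trans (ac-sym u′≈u) (ac-trans u′≈t′ t′≈t)))
    >acmpo-resp-=AC {s} s≈s′ (acmpo2 root-s′ root-t′ f>g tf-t′ s′>TF-t′) t′≈t
      with Lt , tf-t , m ← transfer (proj₁ (TF-transfer t′≈t)) tf-t′ =
      acmpo2 (RootIs-resp-=AC (ac-sym s≈s′) root-s′) (RootIs-resp-=AC t′≈t root-t′) f>g tf-t s>TF-t
      where
      s>TF-t : ∀ {u} → u ∈ Lt → s >acmpo u
      s>TF-t u∈ with u′ , u′∈ , u≈u′ ← =mul-∈ (=mul-sym m) u∈ =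
        >acmpo-resp-=AC s≈s′ (s′>TF-t′ u′∈) (ac-sym u≈u′)
    >acmpo-resp-=AC s≈s′ (acmpo3 root-s′ root-t′ tf-s′ tf-t′ π-s′ π-t′ S₁≈T₁ S₂≢[] dom) t′≈t
      with _ , tf-s , S₁′ , S₂′ , π-s , S₁′≈S₁ , S₂′≈S₂
             ← transfer-++ (proj₂ (TF-transfer s≈s′)) tf-s′ π-s′
      with _ , tf-t , T₁′ , T₂′ , π-t , T₁′≈T₁ , T₂′≈T₂
             ← transfer-++ (proj₁ (TF-transfer t′≈t)) tf-t′ π-t′ =
      acmpo3 (RootIs-resp-=AC (ac-sym s≈s′) root-s′) (RootIs-resp-=AC t′≈t root-t′) tf-s tf-t π-s π-t
        (=mul-trans S₁′≈S₁ (=mul-trans S₁≈T₁ (=mul-sym T₁′≈T₁)))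
        (λ { refl → S₂≢[] (=mul-empty-inv S₂′≈S₂) })
        dom′
      where
      dom′ : ∀ {u} → u ∈ T₂′ → ∃ λ v → v ∈ S₂′ × v >acmpo u
      dom′ u∈ with u′ , u′∈ , u≈u′ ← =mul-∈ T₂′≈T₂ u∈
              with v′ , v′∈ , v′>u′ ← dom u′∈
              with v , v∈ , v′≈v ← =mul-∈ (=mul-sym S₂′≈S₂) v′∈ =
        v , v∈ , >acmpo-resp-=AC (ac-sym v′≈v) v′>u′ (ac-sym u≈u′)

lemmaA1 : (Sym : Set) (arity : Sym → ℕ) (AC : Sym → Set)
    (AC-binary : ∀ {f} → AC f → arity f ≡ 2) (V : Set)
    (_>_ : Sym → Sym → Set) → IsStrictPartialOrder _≡_ _>_ →
    let open Terms Sym arity AC AC-binary V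
        open ACMPO _>_
    in ∀ {s s′ t′ t} → s =AC s′ → s′ >acmpo t′ → t′ =AC t → s >acmpo t
lemmaA1 Sym arity AC AC-binary V _>_ _ = AC-Compatibility.>acmpo-resp-=AC Sym arity AC AC-binary V _>_
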